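{- For every set $X$ of configurations and every $n$, $\mathrm{ex}(n, X\cup\{\text{mariposa}\}) \ge \mathrm{ex}(n,X)/8$.
   Context: Let $P$ be a set of $n$ points in convex position in the plane (the vertices of a convex $n$-gon); a triangle on $P$ is a 3-element subset of $P$. For two distinct triangles $t_1,t_2$ on $P$, label each point of $t_1\cup t_2$ by the triangle(s) containing it and read the points in their cyclic order around the polygon. The pair forms exactly one of eight configurations. (i) If $t_1,t_2$ share two vertices $u,v$: "taco" if their third vertices lie on the same side of the line $uv$, "mariposa" if on opposite sides. (ii) If they share exactly one vertex $v$: read the remaining four vertices in cyclic order starting just after $v$; "bat" if the pattern is $t_1t_1t_2t_2$ or $t_2t_2t_1t_1$, "nested" if it is $t_1t_2t_2t_1$ or $t_2t_1t_1t_2$, "crossing" if it is $t_1t_2t_1t_2$ or $t_2t_1t_2t_1$. (iii) If they share no vertex, the cyclic sequence of the six labels is, up to rotation, reflection and exchanging the roles of $t_1,t_2$, one of: "ears" $AAABBB$, "swords" $AABABB$, "david" $ABABAB$. For a set $X$ of configurations, $\mathrm{ex}(n,X)$ is the maximum size of a family of triangles on $P$ in which no two triangles form a configuration belonging to $X$ (this depends only on $n$ and $X$). -}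

module Defs where

open import Data.Nat using (ℕ; zero; suc; _+_)
open import Data.Bool using (Bool; true; false; _∨_; _∧_; not; if_then_else_)
open import Data.Fin using (Fin; _<_; _≟_)
open import Data.List using (List; []; _∷_; _++_)
open import Data.List.Membership.Propositional using (_∈_)
open import Data.Product using (_×_; _,_; proj₁; proj₂)
open import Relation.Nullary.Decidable using (⌊_⌋)
open import Relation.Binary.PropositionalEquality using (_≡_; _≢_)

-- Points of P are the vertices 0,1,…,n-1 of a convex n-gon, listed in cyclic order.
-- A triangle is a 3-element subset {a,b,c}, stored in increasing order a < b < c.
-- The order proofs are irrelevant, so two triangles are ≡ iff they have the same vertices.
record Triangle (n : ℕ) : Set where
  constructor tri
  field
    a b c : Fin n
    .a<b : a < b
    .b<c : b < c
open Triangle public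

data Config : Set where
  taco mariposa bat nested crossing ears swords david : Config

isMariposa : Config → Bool
isMariposa mariposa = true
isMariposa _        = false

mem : ∀ {n} → Fin n → Triangle n → Bool
mem p t = ⌊ p ≟ a t ⌋ ∨ ⌊ p ≟ b t ⌋ ∨ ⌊ p ≟ c t ⌋

-- a label: (belongs to t₁ , belongs to t₂)
Label : Set
Label = Bool × Bool

eqB : Bool → Bool → Bool
eqB true  y = y
eqB false y = not y

sameLab : Label → Label → Bool
sameLab (x , y) (x' , y') = eqB x x' ∧ eqB y y'

isBoth : Label → Bool
isBoth (x , y) = x ∧ y

-- labels of the points of t₁ ∪ t₂, in the cyclic order of the polygon (starting at vertex 0)
labelsFrom : ∀ {n} → List (Fin n) → Triangle n → Triangle n → List Label
labelsFrom []       t₁ t₂ = []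
labelsFrom (p ∷ ps) t₁ t₂ with mem p t₁ | mem p t₂
... | false | false = labelsFrom ps t₁ t₂
... | x     | y     = (x , y) ∷ labelsFrom ps t₁ t₂

allPoints : (n : ℕ) → List (Fin n)
allPoints zero    = []
allPoints (suc n) = Fin.zero ∷ Data.List.map Fin.suc (allPoints n)
  where import Data.Fin as Fin

labels : ∀ {n} → Triangle n → Triangle n → List Label
labels {n} t₁ t₂ = labelsFrom (allPoints n) t₁ t₂

countBoth : List Label → ℕ
countBoth []       = 0
countBoth (l ∷ ls) = (if isBoth l then 1 else 0) + countBoth ls

changes : List Label → ℕ
changes (x ∷ y ∷ r) = (if sameLab x y then 0 else 1) + changes (y ∷ r)
changes _           = 0

cyclicChanges : List Label → ℕ
cyclicChanges []       = 0
cyclicChanges (x ∷ xs) = changes ((x ∷ xs) ++ (x ∷ []))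

-- reading order starting just after the (unique) shared vertex: post ++ pre
afterShared : List Label → List Label → List Label
afterShared pre []       = pre
afterShared pre (l ∷ ls) = if isBoth l then ls ++ pre else afterShared (pre ++ (l ∷ [])) ls

-- two shared vertices u,v: labels form a cyclic 4-sequence with two "both" entries;
-- mariposa iff the shared vertices are not cyclically adjacent (third vertices on opposite
-- sides of uv), taco otherwise.
twoShared : List Label → Config
twoShared (w ∷ x ∷ y ∷ z ∷ []) =
  if (isBoth w ∧ isBoth y) ∨ (isBoth x ∧ isBoth z) then mariposa else taco
twoShared _ = taco

-- one shared vertex: pattern of the remaining four labels read after the shared vertex
oneShared : ℕ → Config
oneShared 1 = bat        -- t₁t₁t₂t₂ / t₂t₂t₁t₁
oneShared 2 = nested     -- t₁t₂t₂t₁ / t₂t₁t₁t₂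
oneShared _ = crossing   -- t₁t₂t₁t₂ / t₂t₁t₂t₁ (3 changes)

-- no shared vertex: cyclic 6-sequence; number of cyclic changes 2/4/6
noShared : ℕ → Config
noShared 2 = ears        -- AAABBB
noShared 4 = swords      -- AABABB
noShared _ = david       -- ABABAB

-- configuration formed by two distinct triangles (value for equal triangles is irrelevant)
config : ∀ {n} → Triangle n → Triangle n → Config
config t₁ t₂ with countBoth (labels t₁ t₂)
... | 2 = twoShared (labels t₁ t₂)
... | 1 = oneShared (changes (afterShared [] (labels t₁ t₂)))
... | _ = noShared (cyclicChanges (labels t₁ t₂))

Free : ∀ {n} → (Config → Bool) → List (Triangle n) → Set
Free X F = ∀ {s t} → s ∈ F → t ∈ F → s ≢ t → X (config s t) ≡ false

withMariposa : (Config → Bool) → (Config → Bool)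
withMariposa X k = X k ∨ isMariposa k

module Submission where

-- ex(n, X ∪ {mariposa}) ≥ ex(n, X) / 8, by a random black/white colouring of the polygon.
--
-- Colour each point 0,…,n-1 black (true) or white (false).  A triangle a < b < c is good
-- for a colouring when its middle vertex b is black and its extreme vertices a, c are white.
--
-- Prescribing the colours of k distinct points leaves 2^n / 2^k of the 2^n
--   colourings, so every triangle is good for exactly 2^n / 8 colourings.
-- * Averaging.  Double counting the pairs (colouring, good member of F) yields a colouring
--   for which at least |F| / 8 members of F are good.
-- * Geometry.  If a vertex of a good triangle is the middle vertex of another good triangle,
--   it is the middle vertex of both.  In a mariposa the union q₁ < q₂ < q₃ < q₄ has its
--   shared vertices at q₁, q₃ or at q₂, q₄, and in both cases some shared vertex would be
--   the middle of one triangle but an extreme vertex of the other.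
--
-- Hence the good members of an X-free family F form an (X ∪ {mariposa})-free family G with
-- |F| ≤ 8 |G|.

open import Defs
open import Data.Nat using (ℕ; zero; suc; _+_; _*_; _^_; _≤_; _<_; _≤?_; z<s; s<s)
open import Data.Nat.Properties
  using (+-identityʳ; +-assoc; +-comm; *-zeroʳ; *-comm; *-assoc; *-identityʳ; *-distribˡ-+; *-distribʳ-+;
         +-cancelˡ-≤; +-monoˡ-≤; ≤-trans; ≤-reflexive; <⇒≤; <⇒≱; ≰⇒>; m^n>0;
         +-commutativeSemigroup)
open import Algebra.Properties.CommutativeSemigroup +-commutativeSemigroup using (interchange)
open import Data.Bool using (Bool; true; false; T; _∧_; _∨_; not; if_then_else_)
open import Data.Bool.Properties using (T-∧; T-∨; T-≡; not-involutive)
open import Data.Fin using (Fin; _≟_) renaming (zero to fzero; suc to fsuc; _<_ to _<ᶠ_; _≤_ to _≤ᶠ_)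
import Data.Fin.Properties as Fin
open import Data.Vec using (Vec; []; _∷_; lookup; updateAt)
open import Data.Vec.Properties using (lookup∘updateAt; lookup∘updateAt′)
open import Data.List using (List; []; _∷_; _++_; map; length; filterᵇ)
open import Data.List.Properties using (length-++; length-map)
open import Data.List.Membership.Propositional.Properties using (∈-filter⁻)
open import Data.List.Relation.Unary.All as All using (All; []; _∷_)
import Data.List.Relation.Unary.All.Properties as Allₚ
open import Data.List.Relation.Unary.AllPairs as AllPairs using (AllPairs; []; _∷_)
import Data.List.Relation.Unary.AllPairs.Properties as AllPairsₚ
open import Data.List.Relation.Unary.Unique.Propositional using (Unique)
import Data.List.Relation.Unary.Unique.Propositional.Properties as Uniqueₚ
open import Data.Product using (Σ; _×_; _,_; proj₁; proj₂)
import Data.Product as Product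
open import Data.Sum using (_⊎_; inj₁; inj₂)
import Data.Sum as Sum
open import Data.Empty using (⊥; ⊥-elim)
open import Function using (_∘_; Equivalence)
open import Relation.Nullary using (yes; no)
open import Relation.Nullary.Decidable using (T?; recompute)
open import Relation.Binary.PropositionalEquality
  using (_≡_; _≢_; refl; sym; trans; cong; cong₂; subst; subst₂; module ≡-Reasoning)

sumOver : {A : Set} → (A → ℕ) → List A → ℕ
sumOver h []       = 0
sumOver h (x ∷ xs) = h x + sumOver h xs

indicator : Bool → ℕ
indicator b = if b then 1 else 0

count : {A : Set} → (A → Bool) → List A → ℕ
count P = sumOver (indicator ∘ P)

module _ {A : Set} where

  sumOver-++ : (h : A → ℕ) (xs ys : List A) → sumOver h (xs ++ ys) ≡ sumOver h xs + sumOver h ys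
  sumOver-++ h []       ys = refl
  sumOver-++ h (x ∷ xs) ys =
    trans (cong (h x +_) (sumOver-++ h xs ys)) (sym (+-assoc (h x) (sumOver h xs) (sumOver h ys)))

  sumOver-map : {B : Set} (h : B → ℕ) (g : A → B) (xs : List A) → sumOver h (map g xs) ≡ sumOver (h ∘ g) xs
  sumOver-map h g []       = refl
  sumOver-map h g (x ∷ xs) = cong (h (g x) +_) (sumOver-map h g xs)

  sumOver-cong : {h k : A → ℕ} → (∀ x → h x ≡ k x) → (xs : List A) → sumOver h xs ≡ sumOver k xs
  sumOver-cong h≡k []       = refl
  sumOver-cong h≡k (x ∷ xs) = cong₂ _+_ (h≡k x) (sumOver-cong h≡k xs)

  sumOver-+ : (h k : A → ℕ) (xs : List A) → sumOver (λ x → h x + k x) xs ≡ sumOver h xs + sumOver k xs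
  sumOver-+ h k []       = refl
  sumOver-+ h k (x ∷ xs) =
    trans (cong (h x + k x +_) (sumOver-+ h k xs)) (interchange (h x) (k x) (sumOver h xs) (sumOver k xs))

  sumOver-*ˡ : (m : ℕ) (h : A → ℕ) (xs : List A) → sumOver (λ x → m * h x) xs ≡ m * sumOver h xs
  sumOver-*ˡ m h []       = sym (*-zeroʳ m)
  sumOver-*ˡ m h (x ∷ xs) =
    trans (cong (m * h x +_) (sumOver-*ˡ m h xs)) (sym (*-distribˡ-+ m (h x) (sumOver h xs)))

  sumOver-uniform : (h : A → ℕ) (m c : ℕ) → (∀ x → h x * m ≡ c) → (xs : List A) →
                    sumOver h xs * m ≡ length xs * c
  sumOver-uniform h m c hm≡c []       = refl
  sumOver-uniform h m c hm≡c (x ∷ xs) =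
    trans (*-distribʳ-+ m (h x) (sumOver h xs)) (cong₂ _+_ (hm≡c x) (sumOver-uniform h m c hm≡c xs))

  sumOver-swap : {B : Set} (g : A → B → ℕ) (xs : List A) (ys : List B) →
                 sumOver (λ x → sumOver (g x) ys) xs ≡ sumOver (λ y → sumOver (λ x → g x y) xs) ys
  sumOver-swap g xs []       = sumOver-zero xs
    where
    sumOver-zero : (xs : List A) → sumOver (λ _ → 0) xs ≡ 0
    sumOver-zero []       = refl
    sumOver-zero (_ ∷ xs) = sumOver-zero xs
  sumOver-swap g xs (y ∷ ys) =
    trans (sumOver-+ (λ x → g x y) (λ x → sumOver (g x) ys) xs)
          (cong (sumOver (λ x → g x y) xs +_) (sumOver-swap g xs ys))

  count-true : (xs : List A) → count (λ _ → true) xs ≡ length xs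
  count-true []       = refl
  count-true (_ ∷ xs) = cong suc (count-true xs)

  count-partition : (P Q : A → Bool) (xs : List A) →
                    count P xs ≡ count (λ x → Q x ∧ P x) xs + count (λ x → not (Q x) ∧ P x) xs
  count-partition P Q xs =
    trans (sumOver-cong split xs)
          (sumOver-+ (indicator ∘ (λ x → Q x ∧ P x)) (indicator ∘ (λ x → not (Q x) ∧ P x)) xs)
    where
    split : ∀ x → indicator (P x) ≡ indicator (Q x ∧ P x) + indicator (not (Q x) ∧ P x)
    split x with Q x
    ... | true  = sym (+-identityʳ (indicator (P x)))
    ... | false = refl

  length-filterᵇ : (P : A → Bool) (xs : List A) → length (filterᵇ P xs) ≡ count P xs
  length-filterᵇ P []       = refl
  length-filterᵇ P (x ∷ xs) with P x
  ... | true  = cong suc (length-filterᵇ P xs)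
  ... | false = length-filterᵇ P xs

bool-clash : {u : Bool} → u ≡ false → u ≡ true → ⊥
bool-clash refl ()

Colouring : ℕ → Set
Colouring n = Vec Bool n

colourings : (n : ℕ) → List (Colouring n)
colourings zero    = [] ∷ []
colourings (suc n) = map (false ∷_) (colourings n) ++ map (true ∷_) (colourings n)

length-colourings : (n : ℕ) → length (colourings n) ≡ 2 ^ n
length-colourings zero    = refl
length-colourings (suc n) = begin
  length (map (false ∷_) (colourings n) ++ map (true ∷_) (colourings n))
    ≡⟨ length-++ (map (false ∷_) (colourings n)) ⟩
  length (map (false ∷_) (colourings n)) + length (map (true ∷_) (colourings n))
    ≡⟨ cong₂ _+_ (length-map (false ∷_) (colourings n)) (length-map (true ∷_) (colourings n)) ⟩
  length (colourings n) + length (colourings n)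
    ≡⟨ cong₂ _+_ (length-colourings n) (trans (length-colourings n) (sym (+-identityʳ (2 ^ n)))) ⟩
  2 ^ suc n ∎
  where open ≡-Reasoning

count-colourings-suc : (n : ℕ) (P : Colouring (suc n) → Bool) →
  count P (colourings (suc n)) ≡ count (P ∘ (false ∷_)) (colourings n) + count (P ∘ (true ∷_)) (colourings n)
count-colourings-suc n P =
  trans (sumOver-++ (indicator ∘ P) (map (false ∷_) (colourings n)) (map (true ∷_) (colourings n)))
        (cong₂ _+_ (sumOver-map (indicator ∘ P) (false ∷_) (colourings n))
                   (sumOver-map (indicator ∘ P) (true ∷_) (colourings n)))

toggle : ∀ {n} → Fin n → Colouring n → Colouring n
toggle p f = updateAt f p not

-- toggling a point permutes the colourings, so it does not change any count
count-toggle : (n : ℕ) (p : Fin n) (P : Colouring n → Bool) →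
               count (P ∘ toggle p) (colourings n) ≡ count P (colourings n)
count-toggle (suc n) fzero    P =
  trans (count-colourings-suc n (P ∘ toggle fzero))
        (trans (+-comm (count (P ∘ (true ∷_)) (colourings n)) (count (P ∘ (false ∷_)) (colourings n)))
               (sym (count-colourings-suc n P)))
count-toggle (suc n) (fsuc p) P =
  trans (count-colourings-suc n (P ∘ toggle (fsuc p)))
        (trans (cong₂ _+_ (count-toggle n p (P ∘ (false ∷_))) (count-toggle n p (P ∘ (true ∷_))))
               (sym (count-colourings-suc n P)))

Constraint : ℕ → Set
Constraint n = Fin n × Bool

meets : ∀ {n} → List (Constraint n) → Colouring n → Bool
meets []             f = true
meets ((p , x) ∷ cs) f = eqB (lookup f p) x ∧ meets cs f

Distinct : ∀ {n} → List (Constraint n) → Set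
Distinct = AllPairs (λ u v → proj₁ u ≢ proj₁ v)

eqB-not : ∀ u x → eqB (not u) x ≡ not (eqB u x)
eqB-not true  x = refl
eqB-not false x = sym (not-involutive x)

meets-toggle : ∀ {n} {p : Fin n} (cs : List (Constraint n)) → All (λ c → p ≢ proj₁ c) cs →
               (f : Colouring n) → meets cs (toggle p f) ≡ meets cs f
meets-toggle []             []            f = refl
meets-toggle {p = p} ((q , x) ∷ cs) (p≢q ∷ p∉cs) f =
  cong₂ _∧_ (cong (λ v → eqB v x) (lookup∘updateAt′ q p (p≢q ∘ sym) f)) (meets-toggle cs p∉cs f)

-- one more constraint on a fresh point halves the number of admissible colourings:
-- toggling that point exchanges the colourings giving it colour x and those giving not x
count-meets-cons : ∀ n (p : Fin n) (x : Bool) (cs : List (Constraint n)) → All (λ c → p ≢ proj₁ c) cs →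
  count (meets ((p , x) ∷ cs)) (colourings n) * 2 ≡ count (meets cs) (colourings n)
count-meets-cons n p x cs p∉cs = begin
  count agree C * 2                 ≡⟨ *-comm (count agree C) 2 ⟩
  count agree C + (count agree C + 0) ≡⟨ cong (count agree C +_) (+-identityʳ (count agree C)) ⟩
  count agree C + count agree C     ≡⟨ cong (count agree C +_) (sym toggled) ⟩
  count agree C + count disagree C  ≡⟨ sym (count-partition (meets cs) Q C) ⟩
  count (meets cs) C                ∎
  where
  open ≡-Reasoning
  C : List (Colouring n)
  C = colourings n
  Q : Colouring n → Bool
  Q f = eqB (lookup f p) x
  agree disagree : Colouring n → Bool
  agree    f = Q f ∧ meets cs f
  disagree f = not (Q f) ∧ meets cs f
  disagree-toggle : ∀ f → disagree (toggle p f) ≡ agree f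
  disagree-toggle f = cong₂ _∧_
    (trans (cong (λ v → not (eqB v x)) (lookup∘updateAt p f))
           (trans (cong not (eqB-not (lookup f p) x)) (not-involutive (Q f))))
    (meets-toggle cs p∉cs f)
  toggled : count disagree C ≡ count agree C
  toggled = trans (sym (count-toggle n p disagree))
                  (sumOver-cong (cong indicator ∘ disagree-toggle) C)

count-meets : ∀ n (cs : List (Constraint n)) → Distinct cs →
              count (meets cs) (colourings n) * 2 ^ length cs ≡ 2 ^ n
count-meets n []             []               =
  trans (*-identityʳ _) (trans (count-true (colourings n)) (length-colourings n))
count-meets n ((p , x) ∷ cs) (p∉cs ∷ distinct) = begin
  count (meets ((p , x) ∷ cs)) C * (2 * 2 ^ length cs)
    ≡⟨ sym (*-assoc (count (meets ((p , x) ∷ cs)) C) 2 (2 ^ length cs)) ⟩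
  count (meets ((p , x) ∷ cs)) C * 2 * 2 ^ length cs
    ≡⟨ cong (_* 2 ^ length cs) (count-meets-cons n p x cs p∉cs) ⟩
  count (meets cs) C * 2 ^ length cs
    ≡⟨ count-meets n cs distinct ⟩
  2 ^ n ∎
  where
  open ≡-Reasoning
  C : List (Colouring n)
  C = colourings n

cancel-larger : ∀ {a a' b d} → a + b ≤ a' + d → a' ≤ a → b ≤ d
cancel-larger {a} {a'} {b} {d} sum≤ a'≤a = +-cancelˡ-≤ a b d (≤-trans sum≤ (+-monoˡ-≤ d a'≤a))

averaging : {A : Set} (h : A → ℕ) (c : ℕ) (xs : List A) → 0 < length xs →
            length xs * c ≤ sumOver h xs → Σ A (λ y → c ≤ h y)
averaging h c (x ∷ xs) _ = average-cons x xs
  where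
  -- if the head is below c, the tail still satisfies the averaging hypothesis
  average-cons : ∀ x xs → suc (length xs) * c ≤ h x + sumOver h xs → Σ _ (λ y → c ≤ h y)
  average-cons x []       c≤ = x , subst₂ _≤_ (+-identityʳ c) (+-identityʳ (h x)) c≤
  average-cons x (y ∷ ys) c≤ with c ≤? h x
  ... | yes c≤hx = x , c≤hx
  ... | no  c≰hx = average-cons y ys (cancel-larger c≤ (<⇒≤ (≰⇒> c≰hx)))

module _ {n : ℕ} where

  -- the order proofs stored irrelevantly in a triangle, recovered since _<_ on Fin is decidable
  a<ᵗb : (s : Triangle n) → a s <ᶠ b s
  a<ᵗb (tri a b c a<b b<c) = recompute (a Fin.<? b) a<b

  b<ᵗc : (s : Triangle n) → b s <ᶠ c s
  b<ᵗc (tri a b c a<b b<c) = recompute (b Fin.<? c) b<c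

  _∈ᵗ_ : Fin n → Triangle n → Set
  p ∈ᵗ s = T (mem p s)

  vertex-cases : (p : Fin n) (s : Triangle n) → p ∈ᵗ s → p ≡ a s ⊎ p ≡ b s ⊎ p ≡ c s
  vertex-cases p s p∈s with p ≟ a s | p ≟ b s | p ≟ c s
  ... | yes p≡a | _       | _       = inj₁ p≡a
  ... | no _    | yes p≡b | _       = inj₂ (inj₁ p≡b)
  ... | no _    | no _    | yes p≡c = inj₂ (inj₂ p≡c)
  ... | no _    | no _    | no _    = ⊥-elim p∈s

  lowest : (p : Fin n) (s : Triangle n) → p ∈ᵗ s → a s ≤ᶠ p
  lowest p s p∈s with vertex-cases p s p∈s
  ... | inj₁ refl        = Fin.≤-refl
  ... | inj₂ (inj₁ refl) = <⇒≤ (a<ᵗb s)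
  ... | inj₂ (inj₂ refl) = <⇒≤ (Fin.<-trans (a<ᵗb s) (b<ᵗc s))

  highest : (p : Fin n) (s : Triangle n) → p ∈ᵗ s → p ≤ᶠ c s
  highest p s p∈s with vertex-cases p s p∈s
  ... | inj₁ refl        = <⇒≤ (Fin.<-trans (a<ᵗb s) (b<ᵗc s))
  ... | inj₂ (inj₁ refl) = <⇒≤ (b<ᵗc s)
  ... | inj₂ (inj₂ refl) = Fin.≤-refl

  sandwich : (s : Triangle n) {x y z : Fin n} → x <ᶠ y → y <ᶠ z →
             x ∈ᵗ s → y ∈ᵗ s → z ∈ᵗ s → y ≡ b s
  sandwich s {x} {y} {z} x<y y<z x∈s y∈s z∈s with vertex-cases y s y∈s
  ... | inj₁ refl        = ⊥-elim (<⇒≱ x<y (lowest x s x∈s))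
  ... | inj₂ (inj₁ y≡b)  = y≡b
  ... | inj₂ (inj₂ refl) = ⊥-elim (<⇒≱ y<z (highest z s z∈s))

  no-four-vertices : (s : Triangle n) {x y z w : Fin n} → x <ᶠ y → y <ᶠ z → z <ᶠ w →
                     x ∈ᵗ s → y ∈ᵗ s → z ∈ᵗ s → w ∈ᵗ s → ⊥
  no-four-vertices s x<y y<z z<w x∈s y∈s z∈s w∈s =
    Fin.<-irrefl (trans (sandwich s x<y y<z x∈s y∈s z∈s) (sym (sandwich s y<z z<w y∈s z∈s w∈s))) y<z

module _ {n : ℕ} where

  goodPattern : Triangle n → List (Constraint n)
  goodPattern s = (a s , false) ∷ (b s , true) ∷ (c s , false) ∷ []

  good : Colouring n → Triangle n → Bool
  good f s = meets (goodPattern s) f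

  goodPattern-distinct : (s : Triangle n) → Distinct (goodPattern s)
  goodPattern-distinct s =
    (Fin.<⇒≢ (a<ᵗb s) ∷ Fin.<⇒≢ (Fin.<-trans (a<ᵗb s) (b<ᵗc s)) ∷ []) ∷ (Fin.<⇒≢ (b<ᵗc s) ∷ []) ∷ [] ∷ []

  good-count : (s : Triangle n) → count (λ f → good f s) (colourings n) * 8 ≡ 2 ^ n
  good-count s = count-meets n (goodPattern s) (goodPattern-distinct s)

  good-colours : (f : Colouring n) (s : Triangle n) → T (good f s) →
                 lookup f (a s) ≡ false × lookup f (b s) ≡ true × lookup f (c s) ≡ false
  good-colours f s good-s with lookup f (a s) | lookup f (b s) | lookup f (c s)
  ... | false | true  | false = refl , refl , refl
  ... | false | true  | true  = ⊥-elim good-s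
  ... | false | false | _     = ⊥-elim good-s
  ... | true  | _     | _     = ⊥-elim good-s

  black-is-middle : (f : Colouring n) (s : Triangle n) {p : Fin n} → T (good f s) →
                    p ∈ᵗ s → lookup f p ≡ true → p ≡ b s
  black-is-middle f s {p} good-s p∈s black with vertex-cases p s p∈s | good-colours f s good-s
  ... | inj₁ refl        | white , _ , _ = ⊥-elim (bool-clash white black)
  ... | inj₂ (inj₁ p≡b)  | _             = p≡b
  ... | inj₂ (inj₂ refl) | _ , _ , white = ⊥-elim (bool-clash white black)

  shared-middle : (f : Colouring n) (s t : Triangle n) → T (good f s) → T (good f t) →
                  b s ∈ᵗ t → b s ≡ b t
  shared-middle f s t good-s good-t bs∈t =
    black-is-middle f t good-t bs∈t (proj₁ (proj₂ (good-colours f s good-s)))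

module _ {n : ℕ} where

  Both : Triangle n → Triangle n → Fin n → Set
  Both s t q = q ∈ᵗ s × q ∈ᵗ t

  record Quadruple (s t : Triangle n) : Set where
    constructor quadruple
    field
      q₁ q₂ q₃ q₄ : Fin n
      q₁<q₂ : q₁ <ᶠ q₂
      q₂<q₃ : q₂ <ᶠ q₃
      q₃<q₄ : q₃ <ᶠ q₄
      on₁ : q₁ ∈ᵗ s ⊎ q₁ ∈ᵗ t
      on₂ : q₂ ∈ᵗ s ⊎ q₂ ∈ᵗ t
      on₃ : q₃ ∈ᵗ s ⊎ q₃ ∈ᵗ t
      on₄ : q₄ ∈ᵗ s ⊎ q₄ ∈ᵗ t

  -- the mariposa pattern: the shared vertices are not cyclically adjacent in the union
  MariposaPattern : (s t : Triangle n) → Quadruple s t → Set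
  MariposaPattern s t Q = (Both s t q₁ × Both s t q₃) ⊎ (Both s t q₂ × Both s t q₄)
    where open Quadruple Q

  swap-quadruple : {s t : Triangle n} → Quadruple s t → Quadruple t s
  swap-quadruple (quadruple q₁ q₂ q₃ q₄ q₁<q₂ q₂<q₃ q₃<q₄ on₁ on₂ on₃ on₄) =
    quadruple q₁ q₂ q₃ q₄ q₁<q₂ q₂<q₃ q₃<q₄ (Sum.swap on₁) (Sum.swap on₂) (Sum.swap on₃) (Sum.swap on₄)

  module _ (f : Colouring n) (s t : Triangle n) (good-s : T (good f s)) (good-t : T (good f t))
           (Q : Quadruple s t) where
    open Quadruple Q

    -- shared q₁, q₃ and q₄ ∈ t: q₃ is the middle of t, and q₂ must lie on s, where it is the
    -- middle; then q₃ is a vertex of s and the middle of t, so shared-middle gives q₃ = q₂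
    shared-outer : Both s t q₁ → Both s t q₃ → q₄ ∈ᵗ t → ⊥
    shared-outer (q₁∈s , q₁∈t) (q₃∈s , q₃∈t) q₄∈t with on₂
    ... | inj₂ q₂∈t = no-four-vertices t q₁<q₂ q₂<q₃ q₃<q₄ q₁∈t q₂∈t q₃∈t q₄∈t
    ... | inj₁ q₂∈s = Fin.<-irrefl (trans q₂≡bs (trans (sym bt≡bs) (sym q₃≡bt))) q₂<q₃
      where
      q₃≡bt : q₃ ≡ b t
      q₃≡bt = sandwich t (Fin.<-trans q₁<q₂ q₂<q₃) q₃<q₄ q₁∈t q₃∈t q₄∈t
      q₂≡bs : q₂ ≡ b s
      q₂≡bs = sandwich s q₁<q₂ q₂<q₃ q₁∈s q₂∈s q₃∈s
      bt≡bs : b t ≡ b s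
      bt≡bs = shared-middle f t s good-t good-s (subst (_∈ᵗ s) q₃≡bt q₃∈s)

    -- shared q₂, q₄ and q₁ ∈ s: q₂ is the middle of s, and q₃ must lie on t, where it is the
    -- middle; then q₂ is a vertex of t and the middle of s, so shared-middle gives q₂ = q₃
    shared-inner : Both s t q₂ → Both s t q₄ → q₁ ∈ᵗ s → ⊥
    shared-inner (q₂∈s , q₂∈t) (q₄∈s , q₄∈t) q₁∈s with on₃
    ... | inj₁ q₃∈s = no-four-vertices s q₁<q₂ q₂<q₃ q₃<q₄ q₁∈s q₂∈s q₃∈s q₄∈s
    ... | inj₂ q₃∈t = Fin.<-irrefl (trans q₂≡bs (trans bs≡bt (sym q₃≡bt))) q₂<q₃
      where
      q₂≡bs : q₂ ≡ b s
      q₂≡bs = sandwich s q₁<q₂ (Fin.<-trans q₂<q₃ q₃<q₄) q₁∈s q₂∈s q₄∈s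
      q₃≡bt : q₃ ≡ b t
      q₃≡bt = sandwich t q₂<q₃ q₃<q₄ q₂∈t q₃∈t q₄∈t
      bs≡bt : b s ≡ b t
      bs≡bt = shared-middle f s t good-s good-t (subst (_∈ᵗ t) q₂≡bs q₂∈t)

  good-no-mariposa-pattern : (f : Colouring n) (s t : Triangle n) → T (good f s) → T (good f t) →
                             (Q : Quadruple s t) → MariposaPattern s t Q → ⊥
  good-no-mariposa-pattern f s t good-s good-t Q (inj₁ (both₁ , both₃)) with Quadruple.on₄ Q
  ... | inj₂ q₄∈t = shared-outer f s t good-s good-t Q both₁ both₃ q₄∈t
  ... | inj₁ q₄∈s = shared-outer f t s good-t good-s (swap-quadruple Q)
                      (Product.swap both₁) (Product.swap both₃) q₄∈s
  good-no-mariposa-pattern f s t good-s good-t Q (inj₂ (both₂ , both₄)) with Quadruple.on₁ Q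
  ... | inj₁ q₁∈s = shared-inner f s t good-s good-t Q both₂ both₄ q₁∈s
  ... | inj₂ q₁∈t = shared-inner f t s good-t good-s (swap-quadruple Q)
                      (Product.swap both₂) (Product.swap both₄) q₁∈t

allPoints-increasing : (n : ℕ) → AllPairs _<ᶠ_ (allPoints n)
allPoints-increasing zero    = []
allPoints-increasing (suc n) =
  Allₚ.map⁺ (All.universal (λ _ → z<s) (allPoints n))
  ∷ AllPairsₚ.map⁺ (AllPairs.map s<s (allPoints-increasing n))

map-filterᵇ-cons : {A B : Set} (g : A → B) (P : A → Bool) (x : A) (xs : List A) →
  map g (filterᵇ P (x ∷ xs)) ≡ (if P x then g x ∷ map g (filterᵇ P xs) else map g (filterᵇ P xs))
map-filterᵇ-cons g P x xs with P x
... | true  = refl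
... | false = refl

module _ {n : ℕ} where

  onEither : Triangle n → Triangle n → Fin n → Bool
  onEither s t p = mem p s ∨ mem p t

  labelOf : Triangle n → Triangle n → Fin n → Label
  labelOf s t p = (mem p s , mem p t)

  labelsFrom-filter : (ps : List (Fin n)) (s t : Triangle n) →
                      labelsFrom ps s t ≡ map (labelOf s t) (filterᵇ (onEither s t) ps)
  labelsFrom-filter []       s t = refl
  labelsFrom-filter (p ∷ ps) s t =
    trans labelsFrom-cons (sym (map-filterᵇ-cons (labelOf s t) (onEither s t) p ps))
    where
    rest : List Label
    rest = map (labelOf s t) (filterᵇ (onEither s t) ps)
    labelsFrom-cons : labelsFrom (p ∷ ps) s t ≡
                      (if mem p s ∨ mem p t then (mem p s , mem p t) ∷ rest else rest)
    labelsFrom-cons with mem p s | mem p t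
    ... | false | false = labelsFrom-filter ps s t
    ... | true  | y     = cong ((true , y) ∷_) (labelsFrom-filter ps s t)
    ... | false | true  = cong ((false , true) ∷_) (labelsFrom-filter ps s t)

  union : Triangle n → Triangle n → List (Fin n)
  union s t = filterᵇ (onEither s t) (allPoints n)

  labels-union : (s t : Triangle n) → labels s t ≡ map (labelOf s t) (union s t)
  labels-union = labelsFrom-filter (allPoints n)

  isMariposa-if : ∀ b → isMariposa (if b then mariposa else taco) ≡ b
  isMariposa-if true  = refl
  isMariposa-if false = refl

  read-mariposa : (s t : Triangle n) (qs : List (Fin n)) → AllPairs _<ᶠ_ qs → All (T ∘ onEither s t) qs →
                  isMariposa (twoShared (map (labelOf s t) qs)) ≡ true →
                  Σ (Quadruple s t) (MariposaPattern s t)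
  read-mariposa s t (q₁ ∷ q₂ ∷ q₃ ∷ q₄ ∷ [])
                ((q₁<q₂ ∷ _) ∷ (q₂<q₃ ∷ _) ∷ (q₃<q₄ ∷ _) ∷ _) (on₁ ∷ on₂ ∷ on₃ ∷ on₄ ∷ []) is-mariposa =
    quadruple q₁ q₂ q₃ q₄ q₁<q₂ q₂<q₃ q₃<q₄
              (on-either q₁ on₁) (on-either q₂ on₂) (on-either q₃ on₃) (on-either q₄ on₄) ,
    Sum.map (both-pair q₁ q₃) (both-pair q₂ q₄) (Equivalence.to (T-∨ {shared q₁ q₃} {shared q₂ q₄}) test)
    where
    shared : Fin n → Fin n → Bool
    shared q q' = isBoth (labelOf s t q) ∧ isBoth (labelOf s t q')
    test : T (shared q₁ q₃ ∨ shared q₂ q₄)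
    test = Equivalence.from T-≡ (trans (sym (isMariposa-if (shared q₁ q₃ ∨ shared q₂ q₄))) is-mariposa)
    on-either : ∀ q → T (onEither s t q) → q ∈ᵗ s ⊎ q ∈ᵗ t
    on-either q = Equivalence.to (T-∨ {mem q s} {mem q t})
    both : ∀ q → T (isBoth (labelOf s t q)) → Both s t q
    both q = Equivalence.to (T-∧ {mem q s} {mem q t})
    both-pair : ∀ q q' → T (shared q q') → Both s t q × Both s t q'
    both-pair q q' =
      Product.map (both q) (both q') ∘ Equivalence.to (T-∧ {isBoth (labelOf s t q)} {isBoth (labelOf s t q')})
  read-mariposa s t []                         _ _ ()
  read-mariposa s t (_ ∷ [])                   _ _ ()
  read-mariposa s t (_ ∷ _ ∷ [])               _ _ ()
  read-mariposa s t (_ ∷ _ ∷ _ ∷ [])           _ _ ()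
  read-mariposa s t (_ ∷ _ ∷ _ ∷ _ ∷ _ ∷ _)    _ _ ()

  oneShared-not-mariposa : ∀ k → isMariposa (oneShared k) ≡ false
  oneShared-not-mariposa 0                   = refl
  oneShared-not-mariposa 1                   = refl
  oneShared-not-mariposa 2                   = refl
  oneShared-not-mariposa (suc (suc (suc k))) = refl

  noShared-not-mariposa : ∀ k → isMariposa (noShared k) ≡ false
  noShared-not-mariposa 0                         = refl
  noShared-not-mariposa 1                         = refl
  noShared-not-mariposa 2                         = refl
  noShared-not-mariposa 3                         = refl
  noShared-not-mariposa 4                         = refl
  noShared-not-mariposa (suc (suc (suc (suc (suc k))))) = refl

  config-mariposa : (s t : Triangle n) → isMariposa (config s t) ≡ true →
                    isMariposa (twoShared (labels s t)) ≡ true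
  config-mariposa s t is-mariposa with countBoth (labels s t)
  ... | 2 = is-mariposa
  ... | 1 = ⊥-elim (bool-clash (oneShared-not-mariposa _) is-mariposa)
  ... | 0 = ⊥-elim (bool-clash (noShared-not-mariposa _) is-mariposa)
  ... | suc (suc (suc _)) = ⊥-elim (bool-clash (noShared-not-mariposa _) is-mariposa)

  mariposa-pattern : (s t : Triangle n) → isMariposa (config s t) ≡ true →
                     Σ (Quadruple s t) (MariposaPattern s t)
  mariposa-pattern s t is-mariposa =
    read-mariposa s t (union s t)
      (AllPairsₚ.filter⁺ (T? ∘ onEither s t) (allPoints-increasing n))
      (Allₚ.all-filter (T? ∘ onEither s t) (allPoints n))
      (subst (λ ls → isMariposa (twoShared ls) ≡ true) (labels-union s t) (config-mariposa s t is-mariposa))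

  good-no-mariposa : (f : Colouring n) (s t : Triangle n) → T (good f s) → T (good f t) →
                     isMariposa (config s t) ≡ false
  good-no-mariposa f s t good-s good-t with isMariposa (config s t) in is-mariposa
  ... | false = refl
  ... | true  = ⊥-elim (Product.uncurry (good-no-mariposa-pattern f s t good-s good-t)
                                         (mariposa-pattern s t is-mariposa))

-- Some colouring makes at least an eighth of the members of F good: the pairs
-- (colouring, good member of F) number |F| · 2^n / 8, summed over the 2^n colourings.
good-colouring : ∀ {n} (F : List (Triangle n)) → Σ (Colouring n) (λ f → length F ≤ 8 * count (good f) F)
good-colouring {n} F =
  averaging (λ f → 8 * count (good f) F) (length F) C
            (subst (0 <_) (sym (length-colourings n)) (m^n>0 2 n)) (≤-reflexive pairs)
  where
  open ≡-Reasoning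
  C : List (Colouring n)
  C = colourings n
  pairs : length C * length F ≡ sumOver (λ f → 8 * count (good f) F) C
  pairs = begin
    length C * length F
      ≡⟨ cong (_* length F) (length-colourings n) ⟩
    2 ^ n * length F
      ≡⟨ *-comm (2 ^ n) (length F) ⟩
    length F * 2 ^ n
      ≡⟨ sym (sumOver-uniform (λ s → count (λ f → good f s) C) 8 (2 ^ n) good-count F) ⟩
    sumOver (λ s → count (λ f → good f s) C) F * 8
      ≡⟨ *-comm (sumOver (λ s → count (λ f → good f s) C) F) 8 ⟩
    8 * sumOver (λ s → count (λ f → good f s) C) F
      ≡⟨ cong (8 *_) (sym (sumOver-swap (λ f s → indicator (good f s)) C F)) ⟩
    8 * sumOver (λ f → count (good f) F) C
      ≡⟨ sym (sumOver-*ˡ 8 (λ f → count (good f) F) C) ⟩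
    sumOver (λ f → 8 * count (good f) F) C ∎

lemma1 : (X : Config → Bool) (n : ℕ) (F : List (Triangle n)) → Unique F → Free X F →
         Σ (List (Triangle n)) (λ G → Unique G × Free (withMariposa X) G × length F ≤ 8 * length G)
lemma1 X n F unique-F free-F = G , Uniqueₚ.filter⁺ (T? ∘ good f) unique-F , G-free , G-large
  where
  f : Colouring n
  f = proj₁ (good-colouring F)
  G : List (Triangle n)
  G = filterᵇ (good f) F
  G-free : Free (withMariposa X) G
  G-free s∈G t∈G s≢t with ∈-filter⁻ (T? ∘ good f) s∈G | ∈-filter⁻ (T? ∘ good f) t∈G
  ... | s∈F , good-s | t∈F , good-t rewrite free-F s∈F t∈F s≢t = good-no-mariposa f _ _ good-s good-t
  G-large : length F ≤ 8 * length G
  G-large rewrite length-filterᵇ (good f) F = proj₂ (good-colouring F)
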